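{- Let $m,n,s,k$ be integers such that $2\leqslant s\leqslant n$, $2\leqslant k\leqslant m$ and $ms=nk$. Let $c\geqslant 1$, let $\Gamma$ be an abelian group of order $nkc$, and let $d=\gcd(s,k)$. If there exists an $\mathrm{MRS}_\Gamma(k/d,\,s;\,mdc/k)$, then there exists an $\mathrm{MRS}_\Gamma(m,n;s,k;c)$.
   Context: For an abelian group $\Gamma$ of order $abc$, $\mathrm{MRS}_\Gamma(a,b;c)$ denotes a collection of $c$ (completely filled) arrays of size $a\times b$ with entries in $\Gamma$ such that every element of $\Gamma$ appears exactly once and in exactly one array, and there exist $\omega,\delta\in\Gamma$ such that in every array each row sums to $\omega$ and each column sums to $\delta$. For positive integers $m,n,s,k,c$ and an abelian group $\Gamma$ of order $nkc$, an $\mathrm{MRS}_\Gamma(m,n;s,k;c)$ is a set of $c$ partially filled $m\times n$ arrays (some cells may be empty) with entries in $\Gamma$ such that every element of $\Gamma$ appears exactly once and in a unique array; in every array each row has exactly $s$ filled cells and each column exactly $k$ filled cells; and there exist $\omega,\delta\in\Gamma$ such that in every array each row sums to $\omega$ and each column sums to $\delta$. -}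

module Defs where

open import Level using (_⊔_)
open import Algebra.Bundles using (AbelianGroup)
open import Data.Nat using (ℕ; zero; suc; _+_)
open import Data.Bool using (Bool; true; false; if_then_else_)
open import Data.Maybe using (Maybe; just; nothing; is-just)
open import Data.Fin using (Fin; zero; suc)
open import Data.Product using (Σ; ∃; _×_; _,_)
open import Relation.Binary.PropositionalEquality using (_≡_)

countFin : ∀ {n} → (Fin n → Bool) → ℕ
countFin {zero}  p = 0
countFin {suc n} p = (if p zero then 1 else 0) + countFin (λ j → p (suc j))

module _ {a ℓ} (G : AbelianGroup a ℓ) where
  open AbelianGroup G

  sumFin : ∀ {n} → (Fin n → Carrier) → Carrier
  sumFin {zero}  f = ε
  sumFin {suc n} f = f zero ∙ sumFin (λ j → f (suc j))

  sumPartial : ∀ {n} → (Fin n → Maybe Carrier) → Carrier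
  sumPartial f = sumFin (λ j → fromM (f j))
    where
      fromM : Maybe Carrier → Carrier
      fromM (just x) = x
      fromM nothing  = ε

  HasOrder : ℕ → Set (a ⊔ ℓ)
  HasOrder N = Σ (Fin N → Carrier) λ e →
    (∀ i j → e i ≈ e j → i ≡ j) × (∀ g → ∃ λ i → e i ≈ g)

  -- MRS_Γ(p,q;c): c completely filled p×q arrays (A t i j = entry of array t
  -- at row i, column j), every element of Γ appearing exactly once overall,
  -- with common row sum ω and common column sum δ.
  MRS : (p q c : ℕ) → Set (a ⊔ ℓ)
  MRS p q c = Σ (Fin c → Fin p → Fin q → Carrier) λ A →
      (∀ t i j t' i' j' → A t i j ≈ A t' i' j' → t ≡ t' × i ≡ i' × j ≡ j')
    × (∀ g → ∃ λ t → ∃ λ i → ∃ λ j → A t i j ≈ g)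
    × (∃ λ ω → ∃ λ δ →
         (∀ t i → sumFin (λ j → A t i j) ≈ ω)
       × (∀ t j → sumFin (λ i → A t i j) ≈ δ))

  -- MRS_Γ(m,n;s,k;c): c partially filled m×n arrays (nothing = empty cell),
  -- every element of Γ appearing exactly once overall, each row with exactly
  -- s filled cells, each column with exactly k filled cells, common row sum ω
  -- and common column sum δ.
  MRSp : (m n s k c : ℕ) → Set (a ⊔ ℓ)
  MRSp m n s k c = Σ (Fin c → Fin m → Fin n → Maybe Carrier) λ A →
      (∀ t i j t' i' j' x y → A t i j ≡ just x → A t' i' j' ≡ just y → x ≈ y →
         t ≡ t' × i ≡ i' × j ≡ j')
    × (∀ g → ∃ λ t → ∃ λ i → ∃ λ j → ∃ λ x → A t i j ≡ just x × x ≈ g)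
    × (∀ t i → countFin (λ j → is-just (A t i j)) ≡ s)
    × (∀ t j → countFin (λ i → is-just (A t i j)) ≡ k)
    × (∃ λ ω → ∃ λ δ →
         (∀ t i → sumPartial (λ j → A t i j) ≈ ω)
       × (∀ t j → sumPartial (λ i → A t i j) ≈ δ))

{-# OPTIONS --safe #-}
module Submission where

-- Write g = gcd s k, s = g·sg and k = g·kd. As kd and sg are coprime, m·s = n·k
-- gives m = A·kd and n = A·sg, and k ≤ m gives g ≤ A. Cut each m × n array into
-- an A × A grid of kd × sg blocks and, in block-row p, fill the g circulant blocks
-- p + e (mod A), e < g: block p + e receives the e-th group of sg columns of one
-- of the c·A given kd × s arrays. A row of the result is then a full row of a given
-- array (s cells, sum ω), and a column meets g blocks, each contributing a full
-- column of a different given array (k cells, sum g·δ).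

open import Defs
open import Algebra.Bundles using (AbelianGroup; Monoid; CommutativeMonoid)
open import Data.Bool using (Bool; if_then_else_)
open import Data.Empty using (⊥-elim)
open import Data.Fin using (Fin; zero; suc; toℕ; fromℕ<; inject≤; _↑ˡ_; _↑ʳ_; combine; remQuot; quotient; remainder; punchIn; punchOut)
open import Data.Fin.Properties using (punchIn-injective; punchInᵢ≢i; punchIn-punchOut; punchOut-injective; 0≢1+n; suc-injective; toℕ-fromℕ<; toℕ-injective; toℕ<n; toℕ≤n; toℕ-inject≤; remQuot-combine; combine-remQuot; combine-injective; combine-surjective)
open import Data.Maybe as Maybe using (Maybe; just; nothing; is-just; fromMaybe)
open import Data.Maybe.Properties using (just-injective)
open import Data.Nat using (ℕ; zero; suc; _+_; _*_; _∸_; _≤_; _<_; _<?_; NonZero; ≢-nonZero; >-nonZero; >-nonZero⁻¹; ≢-nonZero⁻¹; z<s)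
open import Data.Nat.Coprimality as Coprimality using (Coprime; coprime-/gcd; coprime-divisor)
open import Data.Nat.Divisibility using (_∣_; divides)
open import Data.Nat.DivMod using (_%_; _mod_; _/_; %-distribˡ-+; m%n%n≡m%n; [m+n]%n≡m%n; m<n⇒m%n≡m; m*n/n≡m; /-congˡ)
open import Data.Nat.GCD using (gcd; gcd[m,n]∣m; gcd[m,n]≢0)
open import Data.Nat.Properties using (+-0-commutativeMonoid; +-comm; +-assoc; m+[n∸m]≡n; m∸n+n≡m; *-comm; *-assoc; *-cancelʳ-≡; *-cancelʳ-≤; ≤-trans; <-≤-trans; ≤-reflexive; m*n≢0⇒m≢0)
open import Data.Product using (∃; _×_; _,_; proj₁; proj₂; uncurry; map₁)
open import Data.Sum using (_⊎_; inj₁; inj₂)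
open import Function using (_∘_)
open import Function.Definitions using (Injective)
open import Relation.Binary.PropositionalEquality as ≡ using (_≡_; _≢_; refl; cong; cong₂; subst₂)
open import Relation.Nullary using (yes; no; contradiction)

remQuot-injective : ∀ {m} n {i j : Fin (m * n)} → remQuot {m} n i ≡ remQuot n j → i ≡ j
remQuot-injective {m} n {i} {j} eq =
  ≡.trans (≡.sym (combine-remQuot {m} n i)) (≡.trans (cong (uncurry combine) eq) (combine-remQuot {m} n j))

mapQuotient : ∀ {m m′} n → (Fin m → Fin m′) → Fin (m * n) → Fin (m′ * n)
mapQuotient {m} n f i = combine (f (quotient {m} n i)) (remainder {m} n i)

mapQuotient-combine : ∀ {m m′} n (f : Fin m → Fin m′) e u → mapQuotient n f (combine e u) ≡ combine (f e) u
mapQuotient-combine n f e u = cong (uncurry combine ∘ map₁ f) (remQuot-combine e u)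

mapQuotient-injective : ∀ {m m′} n {f : Fin m → Fin m′} → Injective _≡_ _≡_ f → Injective _≡_ _≡_ (mapQuotient n f)
mapQuotient-injective {m} n f-injective {i} {j} eq with fq≡fq′ , r≡r′ ← combine-injective _ _ _ _ eq =
  remQuot-injective {m} n (cong₂ _,_ (f-injective fq≡fq′) r≡r′)

module _ {a ℓ} (M : Monoid a ℓ) where
  open Monoid M renaming (refl to ≈-refl)
  open import Algebra.Properties.Monoid.Sum M
  open import Relation.Binary.Reasoning.Setoid setoid

  sum-↑ : ∀ m {n} (f : Fin (m + n) → Carrier) → sum f ≈ sum (f ∘ (_↑ˡ n)) ∙ sum (f ∘ (m ↑ʳ_))
  sum-↑ zero    f = sym (identityˡ _)
  sum-↑ (suc m) {n} f = begin
    f zero ∙ sum (f ∘ suc)                                      ≈⟨ ∙-congˡ (sum-↑ m (f ∘ suc)) ⟩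
    f zero ∙ (sum (f ∘ suc ∘ (_↑ˡ n)) ∙ sum (f ∘ suc ∘ (m ↑ʳ_))) ≈⟨ assoc _ _ _ ⟨
    (f zero ∙ sum (f ∘ suc ∘ (_↑ˡ n))) ∙ sum (f ∘ suc ∘ (m ↑ʳ_)) ∎

  sum-combine : ∀ m {n} (f : Fin (m * n) → Carrier) →
                sum f ≈ ∑[ i < m ] ∑[ j < n ] f (combine i j)
  sum-combine zero        f = ≈-refl
  sum-combine (suc m) {n} f = trans (sum-↑ n {m * n} f) (∙-congˡ (sum-combine m (f ∘ (n ↑ʳ_))))

record Enumeration {ℓ} {X : Set ℓ} {N d : ℕ} (F : Fin N → Maybe X) (h : Fin d → X) : Set ℓ where
  field
    position           : Fin d → Fin N
    position-injective : Injective _≡_ _≡_ position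
    at-position        : ∀ y → F (position y) ≡ just (h y)
    only-positions     : ∀ {j x} → F j ≡ just x → ∃ λ y → position y ≡ j

module _ {a ℓ} (M : CommutativeMonoid a ℓ) where
  open CommutativeMonoid M renaming (refl to ≈-refl)
  open import Algebra.Properties.CommutativeMonoid.Sum M
  open import Relation.Binary.Reasoning.Setoid setoid

  sum-image : ∀ {d N} (f : Fin N → Carrier) {ι : Fin d → Fin N} → Injective _≡_ _≡_ ι →
              (∀ j → f j ≈ ε ⊎ ∃ λ y → ι y ≡ j) → sum f ≈ sum (f ∘ ι)
  sum-image {zero} {N} f _ image = trans (sum-cong-≋ vanishes) (sum-replicate-zero N)
    where
    vanishes : ∀ j → f j ≈ ε
    vanishes j with image j
    ... | inj₁ fj≈ε = fj≈ε
    ... | inj₂ (() , _)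
  sum-image {suc d} {zero}  f {ι} _ _ with ι zero
  ... | ()
  sum-image {suc d} {suc N} f {ι} ι-injective image = begin
    sum f                                ≈⟨ sum-remove f ⟩
    f i₀ ∙ sum (f ∘ punchIn i₀)          ≈⟨ ∙-congˡ (sum-image (f ∘ punchIn i₀) ι′-injective image′) ⟩
    f i₀ ∙ sum (f ∘ punchIn i₀ ∘ ι′)     ≡⟨ cong (f i₀ ∙_) (sum-cong-≗ (cong f ∘ punchIn-punchOut ∘ i₀≢ι∘suc)) ⟩
    f i₀ ∙ sum (f ∘ ι ∘ suc)             ∎
    where
    i₀ = ι zero
    i₀≢ι∘suc : ∀ y → i₀ ≢ ι (suc y)
    i₀≢ι∘suc y = 0≢1+n ∘ ι-injective
    ι′ : Fin d → Fin N
    ι′ y = punchOut (i₀≢ι∘suc y)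
    ι′-injective : Injective _≡_ _≡_ ι′
    ι′-injective = suc-injective ∘ ι-injective ∘ punchOut-injective (i₀≢ι∘suc _) (i₀≢ι∘suc _)
    image′ : ∀ j → f (punchIn i₀ j) ≈ ε ⊎ ∃ λ y → ι′ y ≡ j
    image′ j with image (punchIn i₀ j)
    ... | inj₁ fj≈ε = inj₁ fj≈ε
    ... | inj₂ (zero  , ι₀≡j) = ⊥-elim (punchInᵢ≢i i₀ j (≡.sym ι₀≡j))
    ... | inj₂ (suc y , ιy≡j) = inj₂ (y , punchIn-injective i₀ _ _ (≡.trans (punchIn-punchOut (i₀≢ι∘suc y)) ιy≡j))

  sum-enumeration : ∀ {ℓ′} {X : Set ℓ′} {N d} {F : Fin N → Maybe X} {h : Fin d → X} →
                    Enumeration F h → (φ : Maybe X → Carrier) → φ nothing ≈ ε →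
                    sum (φ ∘ F) ≈ sum (φ ∘ just ∘ h)
  sum-enumeration {F = F} {h} E φ φ-nothing = begin
    sum (φ ∘ F)            ≈⟨ sum-image (φ ∘ F) position-injective image ⟩
    sum (φ ∘ F ∘ position) ≡⟨ sum-cong-≗ (cong φ ∘ at-position) ⟩
    sum (φ ∘ just ∘ h)     ∎
    where
    open Enumeration E
    image : ∀ j → φ (F j) ≈ ε ⊎ ∃ λ y → position y ≡ j
    image j with F j in Fj≡
    ... | nothing = inj₁ φ-nothing
    ... | just _  = inj₂ (only-positions Fj≡)

module _ {ℓ} {X : Set ℓ} {N d : ℕ} {F : Fin N → Maybe X} {h : Fin d → X} (E : Enumeration F h) where
  open import Algebra.Properties.CommutativeMonoid.Sum +-0-commutativeMonoid
  open ≡.≡-Reasoning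

  countFin-enumeration : countFin (is-just ∘ F) ≡ d
  countFin-enumeration = begin
    countFin (is-just ∘ F)        ≡⟨ countFin≡sum (is-just ∘ F) ⟩
    sum (indicator ∘ is-just ∘ F) ≡⟨ sum-enumeration +-0-commutativeMonoid E (indicator ∘ is-just) refl ⟩
    sum {d} (λ _ → 1)             ≡⟨ sum-ones d ⟩
    d                             ∎
    where
    indicator : Bool → ℕ
    indicator b = if b then 1 else 0
    countFin≡sum : ∀ {n} (p : Fin n → Bool) → countFin p ≡ sum (indicator ∘ p)
    countFin≡sum {zero}  p = refl
    countFin≡sum {suc n} p = cong (indicator (p zero) +_) (countFin≡sum (p ∘ suc))
    sum-ones : ∀ n → sum {n} (λ _ → 1) ≡ n
    sum-ones zero    = refl
    sum-ones (suc n) = cong suc (sum-ones n)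

module _ {a ℓ} (G : AbelianGroup a ℓ) where
  open AbelianGroup G renaming (refl to ≈-refl)
  open import Algebra.Properties.CommutativeMonoid.Sum commutativeMonoid

  sumFin≡sum : ∀ {n} (f : Fin n → Carrier) → sumFin G f ≡ sum f
  sumFin≡sum {zero}  f = refl
  sumFin≡sum {suc n} f = cong (f zero ∙_) (sumFin≡sum (f ∘ suc))

  sumPartial≡sum : ∀ {n} (f : Fin n → Maybe Carrier) → sumPartial G f ≡ sum (fromMaybe ε ∘ f)
  sumPartial≡sum {zero}  f = refl
  sumPartial≡sum {suc n} f with f zero
  ... | just x  = cong (x ∙_) (sumPartial≡sum (f ∘ suc))
  ... | nothing = cong (ε ∙_) (sumPartial≡sum (f ∘ suc))

  sumPartial-enumeration : ∀ {N d} {F : Fin N → Maybe Carrier} {h : Fin d → Carrier} →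
                           Enumeration F h → sumPartial G F ≈ sumFin G h
  sumPartial-enumeration {F = F} {h} E = begin
    sumPartial G F         ≡⟨ sumPartial≡sum F ⟩
    sum (fromMaybe ε ∘ F)  ≈⟨ sum-enumeration commutativeMonoid E (fromMaybe ε) ≈-refl ⟩
    sum h                  ≡⟨ sumFin≡sum h ⟨
    sumFin G h             ∎
    where open import Relation.Binary.Reasoning.Setoid setoid

module Cyclic (A : ℕ) .{{_ : NonZero A}} where
  open ≡.≡-Reasoning

  infixl 6 _⊕_ _⊖_

  _⊕_ : Fin A → Fin A → Fin A
  x ⊕ y = (toℕ x + toℕ y) mod A

  _⊖_ : Fin A → Fin A → Fin A
  x ⊖ y = (toℕ x + (A ∸ toℕ y)) mod A

  ⊕-comm : ∀ x y → x ⊕ y ≡ y ⊕ x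
  ⊕-comm x y = cong (_mod A) (+-comm (toℕ x) (toℕ y))

  private
    [m%A+n]%A≡[m+n]%A : ∀ m n → (m % A + n) % A ≡ (m + n) % A
    [m%A+n]%A≡[m+n]%A m n = begin
      (m % A + n) % A         ≡⟨ %-distribˡ-+ (m % A) n A ⟩
      (m % A % A + n % A) % A ≡⟨ cong (λ z → (z + n % A) % A) (m%n%n≡m%n m A) ⟩
      (m % A + n % A) % A     ≡⟨ %-distribˡ-+ m n A ⟨
      (m + n) % A             ∎

    add-add-cancel : ∀ x {m n} → m + n ≡ A → (toℕ ((toℕ x + m) mod A) + n) mod A ≡ x
    add-add-cancel x {m} {n} m+n≡A = toℕ-injective (begin
      toℕ ((toℕ ((toℕ x + m) mod A) + n) mod A) ≡⟨ toℕ-fromℕ< _ ⟩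
      (toℕ ((toℕ x + m) mod A) + n) % A         ≡⟨ cong (λ z → (z + n) % A) (toℕ-fromℕ< _) ⟩
      ((toℕ x + m) % A + n) % A                 ≡⟨ [m%A+n]%A≡[m+n]%A (toℕ x + m) n ⟩
      (toℕ x + m + n) % A                       ≡⟨ cong (_% A) (+-assoc (toℕ x) m n) ⟩
      (toℕ x + (m + n)) % A                     ≡⟨ cong (λ z → (toℕ x + z) % A) m+n≡A ⟩
      (toℕ x + A) % A                           ≡⟨ [m+n]%n≡m%n (toℕ x) A ⟩
      toℕ x % A                                 ≡⟨ m<n⇒m%n≡m (toℕ<n x) ⟩
      toℕ x                                     ∎)

  x⊕y⊖y≡x : ∀ x y → x ⊕ y ⊖ y ≡ x
  x⊕y⊖y≡x x y = add-add-cancel x (m+[n∸m]≡n (toℕ≤n y))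

  x⊖y⊕y≡x : ∀ x y → x ⊖ y ⊕ y ≡ x
  x⊖y⊕y≡x x y = add-add-cancel x (m∸n+n≡m (toℕ≤n y))

module Circulant {A g : ℕ} .{{_ : NonZero A}} (g≤A : g ≤ A) where
  open Cyclic A
  open ≡.≡-Reasoning

  shift : Fin A → Fin g → Fin A
  shift p e = p ⊕ inject≤ e g≤A

  unshift : Fin A → Fin g → Fin A
  unshift q e = q ⊖ inject≤ e g≤A

  offset : Fin A → Fin A → Maybe (Fin g)
  offset p q with toℕ (q ⊖ p) <? g
  ... | yes d<g = just (fromℕ< d<g)
  ... | no  _   = nothing

  shift-unshift : ∀ q e → shift (unshift q e) e ≡ q
  shift-unshift q e = x⊖y⊕y≡x q (inject≤ e g≤A)

  unshift-shift : ∀ p e → unshift (shift p e) e ≡ p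
  unshift-shift p e = x⊕y⊖y≡x p (inject≤ e g≤A)

  toℕ-shift-⊖ : ∀ p e → toℕ (shift p e ⊖ p) ≡ toℕ e
  toℕ-shift-⊖ p e = begin
    toℕ (p ⊕ inject≤ e g≤A ⊖ p) ≡⟨ cong (λ z → toℕ (z ⊖ p)) (⊕-comm p _) ⟩
    toℕ (inject≤ e g≤A ⊕ p ⊖ p) ≡⟨ cong toℕ (x⊕y⊖y≡x _ p) ⟩
    toℕ (inject≤ e g≤A)         ≡⟨ toℕ-inject≤ e g≤A ⟩
    toℕ e                       ∎

  offset-shift : ∀ p e → offset p (shift p e) ≡ just e
  offset-shift p e with toℕ (shift p e ⊖ p) <? g
  ... | yes d<g = cong just (toℕ-injective (≡.trans (toℕ-fromℕ< d<g) (toℕ-shift-⊖ p e)))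
  ... | no  d≮g = contradiction (≡.subst (_< g) (≡.sym (toℕ-shift-⊖ p e)) (toℕ<n e)) d≮g

  offset-unshift : ∀ q e → offset (unshift q e) q ≡ just e
  offset-unshift q e = ≡.subst (λ z → offset (unshift q e) z ≡ just e) (shift-unshift q e) (offset-shift (unshift q e) e)

  offset≡just⇒shift : ∀ {p q e} → offset p q ≡ just e → shift p e ≡ q
  offset≡just⇒shift {p} {q} offset≡e with toℕ (q ⊖ p) <? g
  offset≡just⇒shift {p} {q} refl | yes d<g = begin
    p ⊕ inject≤ (fromℕ< d<g) g≤A ≡⟨ cong (p ⊕_) (toℕ-injective (≡.trans (toℕ-inject≤ _ g≤A) (toℕ-fromℕ< d<g))) ⟩
    p ⊕ (q ⊖ p)                  ≡⟨ ⊕-comm p _ ⟩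
    q ⊖ p ⊕ p                    ≡⟨ x⊖y⊕y≡x q p ⟩
    q                            ∎

  shift-injective : ∀ p → Injective _≡_ _≡_ (shift p)
  shift-injective p {e} {e′} eq = just-injective (begin
    just e            ≡⟨ offset-shift p e ⟨
    offset p (shift p e)  ≡⟨ cong (offset p) eq ⟩
    offset p (shift p e′) ≡⟨ offset-shift p e′ ⟩
    just e′           ∎)

  unshift-injective : ∀ q → Injective _≡_ _≡_ (unshift q)
  unshift-injective q {e} {e′} eq = just-injective (begin
    just e                  ≡⟨ offset-unshift q e ⟨
    offset (unshift q e) q  ≡⟨ cong (λ p → offset p q) eq ⟩
    offset (unshift q e′) q ≡⟨ offset-unshift q e′ ⟩
    just e′                 ∎)

module CirculantArrays {a ℓ} (G : AbelianGroup a ℓ) {A g kd sg c : ℕ} .{{_ : NonZero A}} (g≤A : g ≤ A)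
                       (M : MRS G kd (g * sg) (c * A)) where
  open AbelianGroup G renaming (refl to ≈-refl)
  open Circulant g≤A
  open import Algebra.Properties.CommutativeMonoid.Sum commutativeMonoid
  open import Algebra.Definitions.RawMonoid rawMonoid using () renaming (_×_ to _·_)
  open import Relation.Binary.Reasoning.Setoid setoid

  L : Fin (c * A) → Fin kd → Fin (g * sg) → Carrier
  L = proj₁ M

  L-injective : ∀ T r w T′ r′ w′ → L T r w ≈ L T′ r′ w′ → T ≡ T′ × r ≡ r′ × w ≡ w′
  L-injective = proj₁ (proj₂ M)

  L-surjective : ∀ x → ∃ λ T → ∃ λ r → ∃ λ w → L T r w ≈ x
  L-surjective = proj₁ (proj₂ (proj₂ M))

  ω δ : Carrier
  ω = proj₁ (proj₂ (proj₂ (proj₂ M)))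
  δ = proj₁ (proj₂ (proj₂ (proj₂ (proj₂ M))))

  L-rows : ∀ T r → sumFin G (L T r) ≈ ω
  L-rows = proj₁ (proj₂ (proj₂ (proj₂ (proj₂ (proj₂ M)))))

  L-columns : ∀ T w → sumFin G (λ r → L T r w) ≈ δ
  L-columns = proj₂ (proj₂ (proj₂ (proj₂ (proj₂ (proj₂ M)))))

  -- Row combine p r is row r of block-row p, column combine q u is column u of
  -- block-column q; block-row p of array t draws on the given array combine t p.
  cell : Fin c → Fin A × Fin kd → Fin A × Fin sg → Maybe Carrier
  cell t (p , r) (q , u) = Maybe.map (λ e → L (combine t p) r (combine e u)) (offset p q)

  array : Fin c → Fin (A * kd) → Fin (A * sg) → Maybe Carrier
  array t i j = cell t (remQuot kd i) (remQuot sg j)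

  cell-shift : ∀ t p r e u → cell t (p , r) (shift p e , u) ≡ just (L (combine t p) r (combine e u))
  cell-shift t p r e u = cong (Maybe.map _) (offset-shift p e)

  cell-unshift : ∀ t q r e u → cell t (unshift q e , r) (q , u) ≡ just (L (combine t (unshift q e)) r (combine e u))
  cell-unshift t q r e u = cong (Maybe.map _) (offset-unshift q e)

  cell≡just : ∀ {t p r q u x} → cell t (p , r) (q , u) ≡ just x →
              ∃ λ e → shift p e ≡ q × L (combine t p) r (combine e u) ≡ x
  cell≡just {p = p} {q = q} cell≡x with offset p q in offset≡e
  cell≡just refl | just e = e , offset≡just⇒shift offset≡e , refl

  rowEnumeration : ∀ t i → let (p , r) = remQuot kd i in Enumeration (array t i) (L (combine t p) r)
  rowEnumeration t i = record
    { position           = mapQuotient sg (shift p)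
    ; position-injective = mapQuotient-injective sg (shift-injective p)
    ; at-position        = at-position
    ; only-positions     = only-positions
    }
    where
    p = quotient kd i
    r = remainder {A} kd i
    at-position : ∀ w → array t i (mapQuotient sg (shift p) w) ≡ just (L (combine t p) r w)
    at-position w = ≡.trans (cong (cell t (p , r)) (remQuot-combine _ _))
                   (≡.trans (cell-shift t p r _ _) (cong (just ∘ L (combine t p) r) (combine-remQuot {g} sg w)))
    only-positions : ∀ {j x} → array t i j ≡ just x → ∃ λ w → mapQuotient sg (shift p) w ≡ j
    only-positions {j} array≡x with e , shift≡q , _ ← cell≡just array≡x =
      combine e (remainder {A} sg j) ,
      ≡.trans (mapQuotient-combine sg (shift p) e _) (≡.trans (cong (λ q → combine q _) shift≡q) (combine-remQuot {A} sg j))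

  columnEntry : Fin c → Fin A × Fin sg → Fin g × Fin kd → Carrier
  columnEntry t (q , u) (e , r) = L (combine t (unshift q e)) r (combine e u)

  columnEnumeration : ∀ t j → Enumeration (λ i → array t i j) (columnEntry t (remQuot sg j) ∘ remQuot kd)
  columnEnumeration t j = record
    { position           = mapQuotient kd (unshift q)
    ; position-injective = mapQuotient-injective kd (unshift-injective q)
    ; at-position        = at-position
    ; only-positions     = only-positions
    }
    where
    q = quotient sg j
    u = remainder {A} sg j
    at-position : ∀ v → array t (mapQuotient kd (unshift q) v) j ≡ just (columnEntry t (q , u) (remQuot kd v))
    at-position v = ≡.trans (cong (λ i → cell t i (q , u)) (remQuot-combine _ _)) (cell-unshift t q _ _ u)
    only-positions : ∀ {i x} → array t i j ≡ just x → ∃ λ v → mapQuotient kd (unshift q) v ≡ i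
    only-positions {i} array≡x with e , shift≡q , _ ← cell≡just array≡x =
      combine e (remainder {A} kd i) ,
      ≡.trans (mapQuotient-combine kd (unshift q) e _)
        (≡.trans (cong (λ p → combine p _) (≡.trans (cong (λ q → unshift q e) (≡.sym shift≡q)) (unshift-shift _ e)))
          (combine-remQuot {A} kd i))

  row-sum : ∀ t i → sumPartial G (array t i) ≈ ω
  row-sum t i = trans (sumPartial-enumeration G (rowEnumeration t i)) (L-rows _ _)

  column-sum : ∀ t j → sumPartial G (λ i → array t i j) ≈ g · δ
  column-sum t j = begin
    sumPartial G (λ i → array t i j)                       ≈⟨ sumPartial-enumeration G (columnEnumeration t j) ⟩
    sumFin G (entry ∘ remQuot kd)                          ≡⟨ sumFin≡sum G (entry ∘ remQuot kd) ⟩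
    sum (entry ∘ remQuot kd)                               ≈⟨ sum-combine monoid g (entry ∘ remQuot kd) ⟩
    ∑[ e < g ] ∑[ r < kd ] entry (remQuot kd (combine e r)) ≡⟨ sum-cong-≗ (λ e → sum-cong-≗ (cong entry ∘ remQuot-combine e)) ⟩
    ∑[ e < g ] ∑[ r < kd ] entry (e , r)                    ≡⟨ sum-cong-≗ (λ e → sumFin≡sum G (λ r → entry (e , r))) ⟨
    ∑[ e < g ] sumFin G (λ r → entry (e , r))               ≈⟨ sum-cong-≋ {g} (λ e → L-columns (combine t (unshift q e)) (combine e u)) ⟩
    ∑[ e < g ] δ                                            ≈⟨ sum-replicate g ⟩
    g · δ                                                   ∎
    where
    q = quotient sg j
    u = remainder {A} sg j
    entry : Fin g × Fin kd → Carrier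
    entry = columnEntry t (q , u)

  array-injective : ∀ t i j t′ i′ j′ x y → array t i j ≡ just x → array t′ i′ j′ ≡ just y → x ≈ y →
                    t ≡ t′ × i ≡ i′ × j ≡ j′
  array-injective t i j t′ i′ j′ x y array≡x array≡y x≈y
    with e  , shift≡q  , L≡x ← cell≡just array≡x
       | e′ , shift≡q′ , L≡y ← cell≡just array≡y
    with T≡T′ , r≡r′ , w≡w′ ← L-injective _ _ _ _ _ _ (trans (reflexive L≡x) (trans x≈y (reflexive (≡.sym L≡y))))
    with t≡t′ , p≡p′ ← combine-injective t _ t′ _ T≡T′
       | e≡e′ , u≡u′ ← combine-injective e _ e′ _ w≡w′ =
    t≡t′ ,
    remQuot-injective kd (cong₂ _,_ p≡p′ r≡r′) ,
    remQuot-injective sg (cong₂ _,_ (≡.trans (≡.sym shift≡q) (≡.trans (cong₂ shift p≡p′ e≡e′) shift≡q′)) u≡u′)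

  array-surjective : ∀ x → ∃ λ t → ∃ λ i → ∃ λ j → ∃ λ y → array t i j ≡ just y × y ≈ x
  array-surjective x
    with T , r , w , LTrw≈x ← L-surjective x
    with t , p , refl ← combine-surjective {c} {A} T
       | e , u , refl ← combine-surjective {g} {sg} w =
    t , combine p r , combine (shift p e) u , _ ,
    ≡.trans (cong₂ (cell t) (remQuot-combine p r) (remQuot-combine (shift p e) u)) (cell-shift t p r e u) ,
    LTrw≈x

  mrs : MRSp G (A * kd) (A * sg) (g * sg) (g * kd) c
  mrs = array , array-injective , array-surjective ,
        (λ t i → countFin-enumeration (rowEnumeration t i)) ,
        (λ t j → countFin-enumeration (columnEnumeration t j)) ,
        ω , g · δ , row-sum , column-sum

record BlockDecomposition (m n s k kd mdck c : ℕ) : Set where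
  field
    A g sg    : ℕ
    m≡A*kd    : m ≡ A * kd
    n≡A*sg    : n ≡ A * sg
    s≡g*sg    : s ≡ g * sg
    k≡g*kd    : k ≡ g * kd
    mdck≡c*A  : mdck ≡ c * A
    g≤A       : g ≤ A
    A-nonZero : NonZero A

blockDecomposition : ∀ {m n s k kd mdck c} → 0 < k → k ≤ m → m * s ≡ n * k →
                     kd * gcd s k ≡ k → mdck * k ≡ m * gcd s k * c → BlockDecomposition m n s k kd mdck c
blockDecomposition {m} {n} {s} {k} {kd} {mdck} {c} 0<k k≤m ms≡nk kd*g≡k mdck*k≡m*g*c = record
  { A = A ; g = g ; sg = sg
  ; m≡A*kd = m≡A*kd
  ; n≡A*sg = n≡A*sg
  ; s≡g*sg = ≡.trans s≡sg*g (*-comm sg g)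
  ; k≡g*kd = ≡.trans (≡.sym kd*g≡k) (*-comm kd g)
  ; mdck≡c*A = mdck≡c*A
  ; g≤A = g≤A
  ; A-nonZero = >-nonZero (<-≤-trans (>-nonZero⁻¹ g) g≤A)
  }
  where
  open ≡.≡-Reasoning
  g = gcd s k
  sg = _∣_.quotient (gcd[m,n]∣m s k)
  s≡sg*g : s ≡ sg * g
  s≡sg*g = _∣_.equality (gcd[m,n]∣m s k)
  instance
    k-nonZero : NonZero k
    k-nonZero = >-nonZero 0<k
    g-nonZero : NonZero g
    g-nonZero = ≢-nonZero (gcd[m,n]≢0 s k (inj₂ (≢-nonZero⁻¹ k)))
    kd-nonZero : NonZero kd
    kd-nonZero = m*n≢0⇒m≢0 kd {{≡.subst NonZero (≡.sym kd*g≡k) k-nonZero}}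
  kd-coprime-sg : Coprime kd sg
  kd-coprime-sg = Coprimality.sym (subst₂ Coprime
    (≡.trans (/-congˡ s≡sg*g) (m*n/n≡m sg g))
    (≡.trans (/-congˡ (≡.sym kd*g≡k)) (m*n/n≡m kd g))
    (coprime-/gcd s k))
  m*sg≡n*kd : m * sg ≡ n * kd
  m*sg≡n*kd = *-cancelʳ-≡ (m * sg) (n * kd) g (begin
    m * sg * g   ≡⟨ *-assoc m sg g ⟩
    m * (sg * g) ≡⟨ cong (m *_) s≡sg*g ⟨
    m * s        ≡⟨ ms≡nk ⟩
    n * k        ≡⟨ cong (n *_) kd*g≡k ⟨
    n * (kd * g) ≡⟨ *-assoc n kd g ⟨
    n * kd * g   ∎)
  kd∣m : kd ∣ m
  kd∣m = coprime-divisor kd-coprime-sg (divides n (≡.trans (*-comm sg m) m*sg≡n*kd))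
  A = _∣_.quotient kd∣m
  m≡A*kd : m ≡ A * kd
  m≡A*kd = _∣_.equality kd∣m
  n≡A*sg : n ≡ A * sg
  n≡A*sg = *-cancelʳ-≡ n (A * sg) kd (begin
    n * kd        ≡⟨ m*sg≡n*kd ⟨
    m * sg        ≡⟨ cong (_* sg) m≡A*kd ⟩
    A * kd * sg   ≡⟨ *-assoc A kd sg ⟩
    A * (kd * sg) ≡⟨ cong (A *_) (*-comm kd sg) ⟩
    A * (sg * kd) ≡⟨ *-assoc A sg kd ⟨
    A * sg * kd   ∎)
  mdck≡c*A : mdck ≡ c * A
  mdck≡c*A = *-cancelʳ-≡ mdck (c * A) k (begin
    mdck * k         ≡⟨ mdck*k≡m*g*c ⟩
    m * g * c        ≡⟨ cong (λ x → x * g * c) m≡A*kd ⟩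
    A * kd * g * c   ≡⟨ cong (_* c) (*-assoc A kd g) ⟩
    A * (kd * g) * c ≡⟨ cong (λ x → A * x * c) kd*g≡k ⟩
    A * k * c        ≡⟨ *-comm (A * k) c ⟩
    c * (A * k)      ≡⟨ *-assoc c A k ⟨
    c * A * k        ∎)
  g≤A : g ≤ A
  g≤A = *-cancelʳ-≤ g A kd (≤-trans (≤-reflexive (≡.trans (*-comm g kd) kd*g≡k)) (≤-trans k≤m (≤-reflexive m≡A*kd)))

circulantMRSp : ∀ {a ℓ} (G : AbelianGroup a ℓ) {m n s k kd mdck c} →
                BlockDecomposition m n s k kd mdck c → MRS G kd s mdck → MRSp G m n s k c
circulantMRSp G record { m≡A*kd = refl ; n≡A*sg = refl ; s≡g*sg = refl ; k≡g*kd = refl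
                       ; mdck≡c*A = refl ; g≤A = g≤A ; A-nonZero = A-nonZero } =
  CirculantArrays.mrs G {{A-nonZero}} g≤A

lemma5p11 : ∀ {ℓ₁ ℓ₂} (m n s k c : ℕ) → 2 ≤ s → s ≤ n → 2 ≤ k → k ≤ m → m * s ≡ n * k → 1 ≤ c
    → (G : AbelianGroup ℓ₁ ℓ₂) → HasOrder G (n * k * c)
    → (kd mdck : ℕ) → kd * gcd s k ≡ k → mdck * k ≡ m * gcd s k * c
    → MRS G kd s mdck → MRSp G m n s k c
lemma5p11 m n s k c _ _ 2≤k k≤m ms≡nk _ G _ kd mdck kd*g≡k mdck*k≡m*g*c =
  circulantMRSp G (blockDecomposition (<-≤-trans z<s 2≤k) k≤m ms≡nk kd*g≡k mdck*k≡m*g*c)
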